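{- Let $\ell\ge 4$, and let $k\ge 1$ and $\kappa\ge 0$ be integers such that $\chi(H)\le\kappa$ for every graph $H$ with no hole of length at least $\ell$ and $\omega(H)<k$. For $x\ge 0$ let $\phi_1(x)=2(\ell-3)(\kappa+x)+1$. Then every graph $G$ with no hole of length at least $\ell$ and with $\omega(G)\le k$ is $(1,\phi_1)$-clique-controlled.
   Context: Graphs are finite and simple; $\mathbb{N}$ is the set of nonnegative integers. A hole is an induced subgraph that is a cycle of length at least four (length = number of edges). $\omega$ is clique number and $\chi$ chromatic number. For a clique $X$ of a graph $H$, $N^1_H(X)$ is the set of vertices of $V(H)\setminus X$ adjacent to every vertex of $X$, and $N^2_H(X)$ is the set of vertices of $V(H)\setminus X$ with a neighbour in $N^1_H(X)$ and no neighbour in $X$. For a nondecreasing $\phi:\mathbb{N}\to\mathbb{N}$ and integer $h\ge1$, $G$ is $(h,\phi)$-clique-controlled if for every induced subgraph $H$ of $G$ and every integer $n\ge 0$, if $\chi(H)>\phi(n)$ then there is an $h$-clique $X$ of $H$ with $\chi(H[N^2_H(X)])>n$. -}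

module Defs where

open import Data.Nat using (ℕ; zero; suc; _+_; _*_; _∸_; _≤_)
open import Data.Fin using (Fin; toℕ)
open import Data.Fin.Subset using (Subset; _∈_; _∉_)
open import Data.Bool using (Bool; true; false)
open import Data.Product using (Σ; ∃; _×_; _,_)
open import Data.Sum using (_⊎_)
open import Data.Unit using (⊤)
open import Relation.Binary.PropositionalEquality using (_≡_; _≢_)
open import Relation.Nullary using (¬_)

record Graph : Set where
  field
    size  : ℕ
    adj   : Fin size → Fin size → Bool
    sym   : ∀ u v → adj u v ≡ adj v u
    irrefl : ∀ v → adj v v ≡ false

module _ (G : Graph) where
  open Graph G

  Adj : Fin size → Fin size → Set
  Adj u v = adj u v ≡ true

  -- A clique of size k: k pairwise adjacent (hence distinct) vertices.
  record Clique (k : ℕ) : Set where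
    field
      vert : Fin k → Fin size
      pairwise : ∀ i j → i ≢ j → Adj (vert i) (vert j)

  record CliqueIn (S : Subset size) (k : ℕ) : Set where
    field
      clique : Clique k
      inside : ∀ i → Clique.vert clique i ∈ S

  CliqueNumberBelow : ℕ → Set
  CliqueNumberBelow k = ¬ Clique k

  CycAdj : (m : ℕ) → Fin m → Fin m → Set
  CycAdj m i j = (suc (toℕ i) ≡ toℕ j) ⊎ (suc (toℕ j) ≡ toℕ i)
               ⊎ (toℕ i ≡ 0 × suc (toℕ j) ≡ m) ⊎ (toℕ j ≡ 0 × suc (toℕ i) ≡ m)

  record Hole (m : ℕ) : Set where
    field
      atLeast4 : 4 ≤ m
      vert : Fin m → Fin size
      inj  : ∀ i j → vert i ≡ vert j → i ≡ j
      induced-cycle : ∀ i j → (Adj (vert i) (vert j) → CycAdj m i j)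
                            × (CycAdj m i j → Adj (vert i) (vert j))

  NoHoleAtLeast : ℕ → Set
  NoHoleAtLeast ℓ = ∀ m → ℓ ≤ m → ¬ Hole m

  Colourable : (Fin size → Set) → ℕ → Set
  Colourable P c = Σ ((v : Fin size) → P v → Fin c) λ col →
    ∀ u v (pu : P u) (pv : P v) → Adj u v → col u pu ≢ col v pv

  ChiAtMost : (Fin size → Set) → ℕ → Set
  ChiAtMost P c = Colourable P c

  ChiAbove : (Fin size → Set) → ℕ → Set
  ChiAbove P c = ¬ Colourable P c

  N1 : (S : Subset size) {h : ℕ} → CliqueIn S h → Fin size → Set
  N1 S {h} X v = v ∈ S × (∀ i → v ≢ Clique.vert (CliqueIn.clique X) i)
               × (∀ i → Adj v (Clique.vert (CliqueIn.clique X) i))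

  N2 : (S : Subset size) {h : ℕ} → CliqueIn S h → Fin size → Set
  N2 S {h} X v = v ∈ S × (∀ i → v ≢ Clique.vert (CliqueIn.clique X) i)
               × (∃ λ u → N1 S X u × Adj v u)
               × (∀ i → ¬ Adj v (Clique.vert (CliqueIn.clique X) i))

  CliqueControlled : ℕ → (ℕ → ℕ) → Set
  CliqueControlled h φ = ∀ (S : Subset size) (n : ℕ) →
    ChiAbove (_∈ S) (φ n) →
    Σ (CliqueIn S h) λ X → ChiAbove (N2 S X) n

AllVertices : (G : Graph) → Fin (Graph.size G) → Set
AllVertices G _ = ⊤

φ₁ : (ℓ κ : ℕ) → ℕ → ℕ
φ₁ ℓ κ x = 2 * (ℓ ∸ 3) * (κ + x) + 1

-- Let H = G[S] and suppose every N²({x}) is n-colourable (otherwise {x} is the required clique).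
-- As G[N¹({x})] has clique number below k, every N¹({x}) is κ-colourable too.  Each component of H
-- is coloured by breadth-first layers from a root z: the root gets one colour, and odd and even
-- layers use disjoint palettes of M = (ℓ − 3)(κ + n) colours.  A layer at depth a + 2 is
-- M-colourable by Gyárfás's path argument.  Otherwise, starting from a parent p at depth a + 1,
-- grow an induced path of ℓ − 3 further vertices in the layer, keeping a connected uncolourable part
-- D of the layer attached to its end; each step loses at most κ colours to N¹ of the end, so finally
-- D needs more than (ℓ − 3)n colours and contains a vertex d outside N²({y}) for every y on the path.
-- Extending the path through D to d, the parent q of d and an induced path from q back to p through
-- the shallower layers close a hole of length at least ℓ.

module Submission where

open import Defs
open import Data.Bool using (Bool; true; false; if_then_else_; not; _∧_)
open import Data.Bool.Properties using (∧-comm; ∧-zeroʳ; ∧-conicalˡ; ∧-conicalʳ) renaming (_≟_ to _≟ᵇ_)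
open import Data.Empty using (⊥; ⊥-elim)
open import Data.Fin using (Fin; toℕ; fromℕ<) renaming (zero to fzero; suc to fsuc)
open import Data.Fin.Subset using (Subset)
open import Data.Fin.Properties using (any?; all?; ¬∀⟶∃¬; toℕ-injective; toℕ<n; toℕ-fromℕ<; injective⇒≤)
  renaming (_≟_ to _≟ᶠ_)
open import Data.List using (List; []; _∷_; _++_; _∷ʳ_; length; lookup; initLast; _∷ʳ′_)
open import Data.List.Properties using (length-++; ++-assoc)
open import Data.List.Relation.Unary.All using (All; []; _∷_)
import Data.List.Relation.Unary.All as All
import Data.List.Relation.Unary.All.Properties as All
open import Data.List.Relation.Unary.Any using (Any; here; there)
import Data.List.Relation.Unary.Any as Any
open import Data.List.Membership.Propositional using (_∈_)
open import Data.List.Membership.Propositional.Properties using (∈-lookup)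
open import Data.Maybe using (Maybe; just; nothing; maybe′)
import Data.Maybe as Maybe
open import Data.Nat using (ℕ; zero; suc; _+_; _*_; _∸_; _≤_; _<_; z≤n; s≤s; _<?_; _≤?_; _≟_)
open import Data.Nat.Properties
open import Data.Product using (Σ; _×_; _,_; proj₁; proj₂)
import Data.Product as Product
open import Data.Sum using (_⊎_; inj₁; inj₂; [_,_]′)
import Data.Sum as Sum
open import Data.Unit using (⊤; tt)
import Data.Vec as Vec
open import Data.Vec using (Vec)
open import Data.Vec.Properties using (lookup∘tabulate; []=⇒lookup; lookup⇒[]=)
open import Relation.Binary.Definitions using (tri<; tri≈; tri>)
open import Relation.Binary.PropositionalEquality
open import Relation.Nullary using (¬_; Dec; yes; no; does; contradiction)
open import Relation.Nullary.Decidable using (_×-dec_; _⊎-dec_; _→-dec_; ¬?; map′; dec-true; dec-false; toSum)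
open import Function using (_∘_; const; case_of_)
open import Axiom.UniquenessOfIdentityProofs using (module Decidable⇒UIP)
open Decidable⇒UIP _≟ᵇ_ using () renaming (≡-irrelevant to ≡ᵇ-irrelevant)

least : {P : ℕ → Set} → (∀ k → Dec (P k)) → (n : ℕ) →
        Σ ℕ λ m → m ≤ n × (∀ j → j < m → ¬ P j) × (P m ⊎ m ≡ n)
least P? zero with P? 0
... | yes p = 0 , z≤n , (λ _ ()) , inj₁ p
... | no _  = 0 , z≤n , (λ _ ()) , inj₂ refl
least P? (suc n) with least P? n
... | m , m≤n , below , inj₁ p = m , m≤n⇒m≤1+n m≤n , below , inj₁ p
... | m , m≤n , below , inj₂ refl with P? m
...   | yes p = m , m≤n⇒m≤1+n m≤n , below , inj₁ p
...   | no ¬p = suc m , ≤-refl , below′ , inj₂ refl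
  where
  below′ : ∀ j → j < suc m → ¬ _
  below′ j (s≤s j≤m) with m≤n⇒m<n∨m≡n j≤m
  ... | inj₁ j<m  = below j j<m
  ... | inj₂ refl = ¬p

least-witness : {P : ℕ → Set} → (∀ k → Dec (P k)) → ∀ {k} → P k →
                Σ ℕ λ m → m ≤ k × P m × (∀ j → j < m → ¬ P j)
least-witness P? {k} pk with least P? k
... | m , m≤k , below , inj₁ pm   = m , m≤k , pm , below
... | m , m≤k , below , inj₂ refl = m , m≤k , pk , below

∃-vec? : ∀ {k} m {Q : Vec (Fin k) m → Set} → (∀ w → Dec (Q w)) →
         Dec (Σ (Vec (Fin k) m) Q)
∃-vec? zero Q? with Q? Vec.[]
... | yes q = yes (Vec.[] , q)
... | no ¬q = no λ { (Vec.[] , q) → ¬q q }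
∃-vec? (suc m) Q? with any? (λ a → ∃-vec? m (λ w → Q? (a Vec.∷ w)))
... | yes (a , w , q) = yes (a Vec.∷ w , q)
... | no ¬q = no λ { (a Vec.∷ w , q) → ¬q (a , w , q) }

clamp : (c n : ℕ) → Fin (suc c)
clamp zero    _       = fzero
clamp (suc c) zero    = fzero
clamp (suc c) (suc n) = fsuc (clamp c n)

toℕ-clamp : ∀ c n → n ≤ c → toℕ (clamp c n) ≡ n
toℕ-clamp zero    .zero   z≤n       = refl
toℕ-clamp (suc c) zero    _         = refl
toℕ-clamp (suc c) (suc n) (s≤s n≤c) = cong suc (toℕ-clamp c n n≤c)

firstTrue : ∀ {n} → (Fin n → Bool) → Maybe (Fin n)
firstTrue {zero}  f = nothing
firstTrue {suc n} f with f fzero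
... | true  = just fzero
... | false = Maybe.map fsuc (firstTrue (f ∘ fsuc))

firstTrue-cong : ∀ {n} {f g : Fin n → Bool} → (∀ i → f i ≡ g i) → firstTrue f ≡ firstTrue g
firstTrue-cong {zero}          f≗g = refl
firstTrue-cong {suc n} {f} {g} f≗g rewrite f≗g fzero with g fzero
... | true  = refl
... | false = cong (Maybe.map fsuc) (firstTrue-cong (f≗g ∘ fsuc))

firstTrue-just : ∀ {n} (f : Fin n → Bool) i → f i ≡ true →
                 Σ (Fin n) λ r → firstTrue f ≡ just r × f r ≡ true
firstTrue-just {suc n} f i fi with f fzero in f0
... | true = fzero , refl , f0
firstTrue-just {suc n} f fzero    fi | false = contradiction (trans (sym f0) fi) λ ()
firstTrue-just {suc n} f (fsuc i) fi | false with firstTrue-just (f ∘ fsuc) i fi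
... | r , eq , fr = fsuc r , cong (Maybe.map fsuc) eq , fr

does-true⇒ : ∀ {P : Set} (P? : Dec P) → does P? ≡ true → P
does-true⇒ (yes p) _ = p

all-last : ∀ {A : Set} {P : A → Set} xs {x} → All P (xs ∷ʳ x) → P x
all-last xs = All.head ∘ All.++⁻ʳ xs

all-lookup : ∀ {A : Set} {P : A → Set} {xs : List A} → All P xs → (i : Fin (length xs)) → P (lookup xs i)
all-lookup ps i = All.lookup ps (∈-lookup i)

split-at-first : ∀ {A : Set} {P : A → Set} → (∀ x → Dec (P x)) → ∀ xs d → P d →
  Σ (List A) λ as → Σ A λ b → Σ (List A) λ cs →
    xs ∷ʳ d ≡ as ++ b ∷ cs × All (¬_ ∘ P) as × P b
split-at-first P? [] d pd = [] , d , [] , refl , [] , pd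
split-at-first P? (x ∷ xs) d pd with P? x
... | yes px = [] , x , xs ∷ʳ d , refl , [] , px
... | no ¬px with split-at-first P? xs d pd
...   | as , b , cs , eq , ¬pas , pb = x ∷ as , b , cs , cong (x ∷_) eq , ¬px ∷ ¬pas , pb

length-∷ʳ : ∀ {A : Set} (xs : List A) x → length (xs ∷ʳ x) ≡ suc (length xs)
length-∷ʳ xs x = trans (length-++ xs) (+-comm (length xs) 1)

lookup-∷ʳ-last : ∀ {A : Set} (xs : List A) y k → toℕ k ≡ length xs → lookup (xs ∷ʳ y) k ≡ y
lookup-∷ʳ-last []       y fzero    _ = refl
lookup-∷ʳ-last (x ∷ xs) y (fsuc k) e = lookup-∷ʳ-last xs y k (suc-injective e)

all-∷ʳ-lookup : ∀ {A : Set} {P : A → Set} xs y k → All P xs → ¬ P (lookup (xs ∷ʳ y) k) → toℕ k ≡ length xs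
all-∷ʳ-lookup []       y fzero    _          _  = refl
all-∷ʳ-lookup (x ∷ xs) y fzero    (px ∷ _)   ¬p = ⊥-elim (¬p px)
all-∷ʳ-lookup (x ∷ xs) y (fsuc k) (_ ∷ pxs) ¬p = cong suc (all-∷ʳ-lookup xs y k pxs ¬p)

∷ʳ-uncons : ∀ {A : Set} (xs : List A) x → Σ A λ y → Σ (List A) λ ys → xs ∷ʳ x ≡ y ∷ ys
∷ʳ-uncons []       x = x , [] , refl
∷ʳ-uncons (y ∷ xs) x = y , xs ∷ʳ x , refl

module GraphTheory (G : Graph) where
  open Graph G using (size; adj)

  V : Set
  V = Fin size

  infix 4 _~_ _~?_ _∈ᵇ_

  _~_ : V → V → Set
  u ~ v = Adj G u v

  _~?_ : ∀ u v → Dec (u ~ v)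
  u ~? v = adj u v ≟ᵇ true

  ~-sym : ∀ {u v} → u ~ v → v ~ u
  ~-sym {u} {v} = trans (Graph.sym G v u)

  ~-irrefl : ∀ {u} → ¬ u ~ u
  ~-irrefl {u} u~u with trans (sym u~u) (Graph.irrefl G u)
  ... | ()

  ~⇒≢ : ∀ {u v} → u ~ v → u ≢ v
  ~⇒≢ u~u refl = ~-irrefl u~u

  -- Vertex sets are Boolean-valued so that sets built from them stay decidable.
  VSet : Set
  VSet = V → Bool

  _∈ᵇ_ : V → VSet → Set
  v ∈ᵇ B = B v ≡ true

  _∈ᵇ?_ : ∀ v B → Dec (v ∈ᵇ B)
  v ∈ᵇ? B = B v ≟ᵇ true

  opaque
    ⟦_⟧ : {P : V → Set} → (∀ v → Dec (P v)) → VSet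
    ⟦ P? ⟧ v = does (P? v)

    ∈⟦⟧⁺ : ∀ {P : V → Set} (P? : ∀ v → Dec (P v)) {v} → P v → v ∈ᵇ ⟦ P? ⟧
    ∈⟦⟧⁺ P? {v} = dec-true (P? v)

    ∈⟦⟧⁻ : ∀ {P : V → Set} (P? : ∀ v → Dec (P v)) {v} → v ∈ᵇ ⟦ P? ⟧ → P v
    ∈⟦⟧⁻ P? {v} = does-true⇒ (P? v)

    ∉⟦⟧⁺ : ∀ {P : V → Set} (P? : ∀ v → Dec (P v)) {v} → ¬ P v → ⟦ P? ⟧ v ≡ false
    ∉⟦⟧⁺ P? {v} = dec-false (P? v)

  _⊆ᵇ_ : VSet → VSet → Set
  A ⊆ᵇ B = ∀ {v} → v ∈ᵇ A → v ∈ᵇ B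

  Colouring : VSet → ℕ → Set
  Colouring B c = Σ (V → ℕ) λ f → (∀ {v} → v ∈ᵇ B → f v < c) ×
                  (∀ {u v} → u ∈ᵇ B → v ∈ᵇ B → u ~ v → f u ≢ f v)

  colouring-⊆ : ∀ {A B c} → A ⊆ᵇ B → Colouring B c → Colouring A c
  colouring-⊆ A⊆B (f , bound , proper) = f , bound ∘ A⊆B , λ u∈A v∈A → proper (A⊆B u∈A) (A⊆B v∈A)

  colouring-mono : ∀ {B c c′} → c ≤ c′ → Colouring B c → Colouring B c′
  colouring-mono c≤c′ (f , bound , proper) = f , (λ v∈B → ≤-trans (bound v∈B) c≤c′) , proper

  colouring-∅ : ∀ {B c} → (∀ v → ¬ v ∈ᵇ B) → Colouring B c
  colouring-∅ empty = (λ _ → 0) , (λ {v} v∈B → ⊥-elim (empty v v∈B)) , λ {u} u∈B → ⊥-elim (empty u u∈B)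

  colouring-∪ : ∀ {A B C x y} → Colouring A x → Colouring B y →
                (∀ {v} → v ∈ᵇ C → v ∈ᵇ A ⊎ v ∈ᵇ B) → Colouring C (x + y)
  colouring-∪ {A} {B} {C} {x} {y} (f , bf , pf) (g , bg , pg) cover = h , bound , proper
    where
    h : V → ℕ
    h v = if A v then f v else x + g v
    bound : ∀ {v} → v ∈ᵇ C → h v < x + y
    bound {v} v∈C with A v in v∈A | cover v∈C
    ... | true  | _        = ≤-trans (bf v∈A) (m≤m+n x y)
    ... | false | inj₁ ()
    ... | false | inj₂ v∈B = +-monoʳ-< x (bg v∈B)
    proper : ∀ {u v} → u ∈ᵇ C → v ∈ᵇ C → u ~ v → h u ≢ h v
    proper {u} {v} u∈C v∈C u~v with A u in u∈A | A v in v∈A | cover u∈C | cover v∈C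
    ... | true  | true  | _ | _ = pf u∈A v∈A u~v
    ... | true  | false | _ | _ = λ e → <-irrefl e (≤-trans (bf u∈A) (m≤m+n x (g v)))
    ... | false | true  | _ | _ = λ e → <-irrefl (sym e) (≤-trans (bf v∈A) (m≤m+n x (g u)))
    ... | false | false | inj₁ () | _
    ... | false | false | _ | inj₁ ()
    ... | false | false | inj₂ u∈B | inj₂ v∈B = λ e → pg u∈B v∈B u~v (+-cancelˡ-≡ x _ _ e)

  -- Colourings are searched for among the finitely many maps into Fin (suc c).
  colouring? : ∀ B c → Dec (Colouring B c)
  colouring? B c = map′ fromVec toVec (∃-vec? size valid?)
    where
    Valid : Vec (Fin (suc c)) size → Set
    Valid w = (∀ v → v ∈ᵇ B → toℕ (Vec.lookup w v) < c) ×
              (∀ u v → u ∈ᵇ B → v ∈ᵇ B → u ~ v → toℕ (Vec.lookup w u) ≢ toℕ (Vec.lookup w v))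
    valid? : ∀ w → Dec (Valid w)
    valid? w = all? (λ v → v ∈ᵇ? B →-dec toℕ (Vec.lookup w v) <? c) ×-dec
               all? (λ u → all? (λ v → u ∈ᵇ? B →-dec (v ∈ᵇ? B →-dec
                 (u ~? v →-dec ¬? (toℕ (Vec.lookup w u) ≟ toℕ (Vec.lookup w v))))))
    fromVec : Σ _ Valid → Colouring B c
    fromVec (w , bound , proper) = (λ v → toℕ (Vec.lookup w v)) , bound _ , proper _ _
    toVec : Colouring B c → Σ _ Valid
    toVec (f , bound , proper) = w , bound′ , proper′
      where
      w = Vec.tabulate (λ v → clamp c (f v))
      w≗f : ∀ {v} → v ∈ᵇ B → toℕ (Vec.lookup w v) ≡ f v
      w≗f {v} v∈B = trans (cong toℕ (lookup∘tabulate _ v)) (toℕ-clamp c (f v) (<⇒≤ (bound v∈B)))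
      bound′ : ∀ v → v ∈ᵇ B → toℕ (Vec.lookup w v) < c
      bound′ v v∈B = subst (_< c) (sym (w≗f v∈B)) (bound v∈B)
      proper′ : ∀ u v → u ∈ᵇ B → v ∈ᵇ B → u ~ v → toℕ (Vec.lookup w u) ≢ toℕ (Vec.lookup w v)
      proper′ u v u∈B v∈B u~v rewrite w≗f u∈B | w≗f v∈B = proper u∈B v∈B u~v

  Colourable⇒Colouring : ∀ {P : V → Set} {B c} → (∀ {v} → v ∈ᵇ B → P v) → Colourable G P c → Colouring B c
  Colourable⇒Colouring {P} {B} {c} B⊆P (col , proper) = f , bound , proper′
    where
    pick : ∀ v b → B v ≡ b → ℕ
    pick v true  v∈B = toℕ (col v (B⊆P v∈B))
    pick v false _   = 0
    f : V → ℕ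
    f v = pick v (B v) refl
    pick-spec : ∀ v b (e : B v ≡ b) (v∈B : v ∈ᵇ B) → pick v b e ≡ toℕ (col v (B⊆P v∈B))
    pick-spec v true  e v∈B rewrite ≡ᵇ-irrelevant e v∈B = refl
    pick-spec v false e v∈B = contradiction (trans (sym e) v∈B) λ ()
    f-spec : ∀ {v} (v∈B : v ∈ᵇ B) → f v ≡ toℕ (col v (B⊆P v∈B))
    f-spec = pick-spec _ _ refl
    bound : ∀ {v} → v ∈ᵇ B → f v < c
    bound v∈B rewrite f-spec v∈B = toℕ<n _
    proper′ : ∀ {u v} → u ∈ᵇ B → v ∈ᵇ B → u ~ v → f u ≢ f v
    proper′ u∈B v∈B u~v rewrite f-spec u∈B | f-spec v∈B = proper _ _ _ _ u~v ∘ toℕ-injective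

  Colouring⇒Colourable : ∀ {P : V → Set} {B c} → (∀ {v} → P v → v ∈ᵇ B) → Colouring B c → Colourable G P c
  Colouring⇒Colourable P⊆B (f , bound , proper) =
    (λ v pv → fromℕ< (bound (P⊆B pv))) ,
    λ u v pu pv u~v e → proper (P⊆B pu) (P⊆B pv) u~v
      (trans (sym (toℕ-fromℕ< _)) (trans (cong toℕ e) (toℕ-fromℕ< _)))

  Apart : V → V → Set
  Apart x z = x ≢ z × ¬ x ~ z

  InducedPath : List V → Set
  InducedPath []           = ⊤
  InducedPath (x ∷ [])     = ⊤
  InducedPath (x ∷ y ∷ zs) = x ~ y × All (Apart x) zs × InducedPath (y ∷ zs)

  ip-tail : ∀ {x xs} → InducedPath (x ∷ xs) → InducedPath xs
  ip-tail {xs = []}    _            = tt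
  ip-tail {xs = _ ∷ _} (_ , _ , ip) = ip

  ip-++⁻ˡ : ∀ xs ys → InducedPath (xs ++ ys) → InducedPath xs
  ip-++⁻ˡ []           ys _                = tt
  ip-++⁻ˡ (x ∷ [])     ys _                = tt
  ip-++⁻ˡ (x ∷ y ∷ xs) ys (x~y , apart , ip) = x~y , All.++⁻ˡ xs apart , ip-++⁻ˡ (y ∷ xs) ys ip

  ip-++⁺ : ∀ xs a ys → InducedPath (xs ∷ʳ a) → InducedPath (a ∷ ys) →
           All (λ x → All (Apart x) ys) xs → InducedPath (xs ++ a ∷ ys)
  ip-++⁺ []            a ys _ ip₂ _ = ip₂
  ip-++⁺ (x ∷ [])      a ys (x~a , _ , _) ip₂ (apart ∷ []) = x~a , apart , ip₂
  ip-++⁺ (x ∷ x′ ∷ xs) a ys (x~x′ , apart , ip₁) ip₂ (apart′ ∷ apart″) =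
    x~x′ , All.++⁺ (All.++⁻ˡ xs apart) (All.head (All.++⁻ʳ xs apart) ∷ apart′) ,
    ip-++⁺ (x′ ∷ xs) a ys ip₁ ip₂ apart″

  ip-lookup-≢ : ∀ {xs} → InducedPath xs → ∀ (i j : Fin (length xs)) → toℕ i < toℕ j →
                lookup xs i ≢ lookup xs j
  ip-lookup-≢ {_ ∷ _ ∷ _} (x~y , _ , _)  fzero    (fsuc fzero)     _         = ~⇒≢ x~y
  ip-lookup-≢ {_ ∷ _ ∷ _} (_ , apart , _) fzero   (fsuc (fsuc j)) _         = proj₁ (all-lookup apart j)
  ip-lookup-≢ {_ ∷ _ ∷ _} (_ , _ , ip)   (fsuc i) (fsuc j)        (s≤s i<j) = ip-lookup-≢ ip i j i<j

  ip-lookup-~ : ∀ {xs} → InducedPath xs → ∀ (i j : Fin (length xs)) → toℕ i < toℕ j →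
                lookup xs i ~ lookup xs j → suc (toℕ i) ≡ toℕ j
  ip-lookup-~ {_ ∷ _ ∷ _} _               fzero    (fsuc fzero)     _ _   = refl
  ip-lookup-~ {_ ∷ _ ∷ _} (_ , apart , _) fzero    (fsuc (fsuc j)) _ x~z = ⊥-elim (proj₂ (all-lookup apart j) x~z)
  ip-lookup-~ {_ ∷ _ ∷ _} (_ , _ , ip)    (fsuc i) (fsuc j) (s≤s i<j) x~z = cong suc (ip-lookup-~ ip i j i<j x~z)

  ip-consecutive-~ : ∀ {xs} → InducedPath xs → ∀ (i j : Fin (length xs)) → suc (toℕ i) ≡ toℕ j →
                     lookup xs i ~ lookup xs j
  ip-consecutive-~ {_ ∷ _ ∷ _} (x~y , _ , _) fzero    (fsuc fzero)    _ = x~y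
  ip-consecutive-~ {_ ∷ _ ∷ _} (_ , _ , ip)  (fsuc i) (fsuc j)        e = ip-consecutive-~ ip i j (suc-injective e)

  ip-lookup-injective : ∀ {xs} → InducedPath xs → ∀ i j → lookup xs i ≡ lookup xs j → i ≡ j
  ip-lookup-injective ip i j e with <-cmp (toℕ i) (toℕ j)
  ... | tri< i<j _ _ = ⊥-elim (ip-lookup-≢ ip i j i<j e)
  ... | tri≈ _ i≡j _ = toℕ-injective i≡j
  ... | tri> _ _ j<i = ⊥-elim (ip-lookup-≢ ip j i j<i (sym e))

  ip-length≤size : ∀ {xs} → InducedPath xs → length xs ≤ size
  ip-length≤size ip = injective⇒≤ (ip-lookup-injective ip _ _)

  ip-head-∉ : ∀ {x xs} → InducedPath (x ∷ xs) → All (x ≢_) xs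
  ip-head-∉ {xs = []}    _                 = []
  ip-head-∉ {xs = _ ∷ _} (x~y , apart , _) = ~⇒≢ x~y ∷ All.map proj₁ apart

  ip-last-∉ : ∀ xs l → InducedPath (xs ∷ʳ l) → All (_≢ l) xs
  ip-last-∉ []            l _                 = []
  ip-last-∉ (x ∷ [])      l (x~l , _ , _)     = ~⇒≢ x~l ∷ []
  ip-last-∉ (x ∷ x′ ∷ xs) l (_ , apart , ip)  = proj₁ (all-last xs apart) ∷ ip-last-∉ (x′ ∷ xs) l ip

  ip-last-≁ : ∀ xs w l → InducedPath (xs ++ w ∷ l ∷ []) → All (λ t → ¬ t ~ l) xs
  ip-last-≁ []            w l _                = []
  ip-last-≁ (x ∷ [])      w l (_ , apart , _)  = proj₂ (All.head apart) ∷ []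
  ip-last-≁ (x ∷ x′ ∷ xs) w l (_ , apart , ip) =
    proj₂ (All.head (All.tail (All.++⁻ʳ xs apart))) ∷ ip-last-≁ (x′ ∷ xs) w l ip

  ip-last-~ : ∀ xs w l → InducedPath (xs ++ w ∷ l ∷ []) → w ~ l
  ip-last-~ []       w l (w~l , _ , _) = w~l
  ip-last-~ (x ∷ xs) w l ip            = ip-last-~ xs w l (ip-tail {x} {xs ++ w ∷ l ∷ []} ip)

  data Walk (B : VSet) : V → V → ℕ → Set where
    stop : ∀ {x} → x ∈ᵇ B → Walk B x x 0
    step : ∀ {x y z k} → x ∈ᵇ B → x ~ y → Walk B y z k → Walk B x z (suc k)

  module _ {B : VSet} where

    vertices : ∀ {x y k} → Walk B x y k → List V
    vertices (stop {x} _)       = x ∷ []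
    vertices (step {x} _ _ w) = x ∷ vertices w

    length-vertices : ∀ {x y k} (w : Walk B x y k) → length (vertices w) ≡ suc k
    length-vertices (stop _)     = refl
    length-vertices (step _ _ w) = cong suc (length-vertices w)

    vertices-∈ᵇ : ∀ {x y k} (w : Walk B x y k) → All (_∈ᵇ B) (vertices w)
    vertices-∈ᵇ (stop x∈B)     = x∈B ∷ []
    vertices-∈ᵇ (step x∈B _ w) = x∈B ∷ vertices-∈ᵇ w

    vertices-last : ∀ {x y k} (w : Walk B x y k) → Σ (List V) λ xs → vertices w ≡ xs ∷ʳ y
    vertices-last (stop _)         = [] , refl
    vertices-last (step {x} _ _ w) with vertices-last w
    ... | xs , e = x ∷ xs , cong (x ∷_) e

    vertices-inner : ∀ {x y k} (w : Walk B x y k) → x ≢ y → Σ (List V) λ mid → vertices w ≡ x ∷ mid ∷ʳ y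
    vertices-inner (stop _)         x≢y = ⊥-elim (x≢y refl)
    vertices-inner (step {x} _ _ w) _   = Product.map₂ (cong (x ∷_)) (vertices-last w)

    walk-source : ∀ {x y k} → Walk B x y k → x ∈ᵇ B
    walk-source (stop x∈B)     = x∈B
    walk-source (step x∈B _ _) = x∈B

    walk-target : ∀ {x y k} → Walk B x y k → y ∈ᵇ B
    walk-target (stop y∈B)   = y∈B
    walk-target (step _ _ w) = walk-target w

    _++ʷ_ : ∀ {x y z k l} → Walk B x y k → Walk B y z l → Walk B x z (k + l)
    stop _         ++ʷ w′ = w′
    step x∈B x~y w ++ʷ w′ = step x∈B x~y (w ++ʷ w′)

    _∷ʳʷ_ : ∀ {x y z k} → Walk B x y k → (y ~ z × z ∈ᵇ B) → Walk B x z (suc k)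
    stop y∈B         ∷ʳʷ (y~z , z∈B) = step y∈B y~z (stop z∈B)
    step x∈B x~x′ w ∷ʳʷ e           = step x∈B x~x′ (w ∷ʳʷ e)

    reverseʷ : ∀ {x y k} → Walk B x y k → Walk B y x k
    reverseʷ (stop x∈B)       = stop x∈B
    reverseʷ (step x∈B x~y w) = reverseʷ w ∷ʳʷ (~-sym x~y , x∈B)

    suffixʷ : ∀ {x y k v} (w : Walk B x y k) → v ∈ vertices w → Σ ℕ λ k′ → k′ ≤ k × Walk B v y k′
    suffixʷ (stop x∈B)           (here refl) = 0 , ≤-refl , stop x∈B
    suffixʷ {k = k} w@(step _ _ _) (here refl) = k , ≤-refl , w
    suffixʷ (step _ _ w)         (there v∈w) with suffixʷ w v∈w
    ... | k′ , k′≤k , w′ = k′ , m≤n⇒m≤1+n k′≤k , w′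

    prefixʷ : ∀ {x y k v} (w : Walk B x y k) → v ∈ vertices w → Σ ℕ λ k′ → k′ ≤ k × Walk B x v k′
    prefixʷ (stop x∈B)           (here refl) = 0 , z≤n , stop x∈B
    prefixʷ (step x∈B _ _)       (here refl) = 0 , z≤n , stop x∈B
    prefixʷ (step x∈B x~y w)     (there v∈w) with prefixʷ w v∈w
    ... | k′ , k′≤k , w′ = suc k′ , s≤s k′≤k , step x∈B x~y w′

    initʷ : ∀ {x y k} → Walk B x y (suc k) → Σ V λ p → Walk B x p k × p ~ y
    initʷ (step x∈B x~y (stop _))         = _ , stop x∈B , x~y
    initʷ (step x∈B x~x′ w@(step _ _ _)) with initʷ w
    ... | p , w′ , p~y = p , step x∈B x~x′ w′ , p~y

  restrictʷ : ∀ {B B′ x y k} (w : Walk B x y k) → All (_∈ᵇ B′) (vertices w) → Walk B′ x y k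
  restrictʷ (stop _)       (x∈B′ ∷ [])  = stop x∈B′
  restrictʷ (step _ x~y w) (x∈B′ ∷ B′w) = step x∈B′ x~y (restrictʷ w B′w)

  walk? : ∀ B k x y → Dec (Walk B x y k)
  walk? B zero x y with x ∈ᵇ? B | x ≟ᶠ y
  ... | yes x∈B | yes refl = yes (stop x∈B)
  ... | no x∉B  | _        = no λ { (stop x∈B) → x∉B x∈B }
  ... | yes _   | no x≢y   = no λ { (stop _) → x≢y refl }
  walk? B (suc k) x y with x ∈ᵇ? B | any? (λ z → x ~? z ×-dec walk? B k z y)
  ... | yes x∈B | yes (z , x~z , w) = yes (step x∈B x~z w)
  ... | no x∉B  | _                 = no λ { (step x∈B _ _) → x∉B x∈B }
  ... | yes _   | no ¬w             = no λ { (step {y = z} _ x~z w) → ¬w (z , x~z , w) }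

  ShortestWalkLength : VSet → V → V → ℕ → Set
  ShortestWalkLength B x y k = ∀ j → j < k → ¬ Walk B x y j

  -- A shortcut would give a shorter walk.
  shortest-walk-induced : ∀ {B x y k} (w : Walk B x y k) → ShortestWalkLength B x y k →
                          InducedPath (vertices w)
  shortest-walk-induced (stop _) _ = tt
  shortest-walk-induced (step _ x~y (stop _)) _ = x~y , [] , tt
  shortest-walk-induced {B} {x} {y} {suc (suc k)} (step x∈B x~x′ (step x′∈B x′~x″ w)) shortest =
    x~x′ , All.tabulate apart , shortest-walk-induced (step x′∈B x′~x″ w) shortest′
    where
    shortest′ : ShortestWalkLength B _ y (suc k)
    shortest′ j j<k w′ = shortest (suc j) (s≤s j<k) (step x∈B x~x′ w′)
    apart : ∀ {v} → v ∈ vertices w → Apart x v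
    apart v∈w with suffixʷ w v∈w
    ... | k′ , k′≤k , w′ = (λ { refl → shortest k′ (≤-trans (s≤s k′≤k) (n≤1+n _)) w′ }) ,
                           (λ x~v → shortest (suc k′) (s≤s (s≤s k′≤k)) (step x∈B x~v w′))

  shortest-walk : ∀ {B x y k} → Walk B x y k → Σ ℕ λ j → Walk B x y j × ShortestWalkLength B x y j
  shortest-walk {B} {x} {y} w with least-witness (λ j → walk? B j x y) w
  ... | j , _ , w′ , shortest = j , w′ , shortest

  Reach : VSet → V → V → Set
  Reach B x y = Σ ℕ (Walk B x y)

  reach-trans : ∀ {B x y z} → Reach B x y → Reach B y z → Reach B x z
  reach-trans (_ , w) (_ , w′) = _ , w ++ʷ w′

  reach-sym : ∀ {B x y} → Reach B x y → Reach B y x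
  reach-sym (_ , w) = _ , reverseʷ w

  reach-bounded : ∀ {B x y} → Reach B x y → Σ ℕ λ k → k < size × Walk B x y k
  reach-bounded (_ , w) with shortest-walk w
  ... | j , w′ , shortest =
    j , subst (_≤ size) (length-vertices w′) (ip-length≤size (shortest-walk-induced w′ shortest)) , w′

  reach? : ∀ B x y → Dec (Reach B x y)
  reach? B x y = map′ (λ (k , _ , w) → k , w) reach-bounded (anyUpTo? (λ k → walk? B k x y) size)

  opaque
    component : VSet → V → VSet
    component B x = ⟦ reach? B x ⟧

    ∈component⁺ : ∀ {B x v} → Reach B x v → v ∈ᵇ component B x
    ∈component⁺ {B} {x} = ∈⟦⟧⁺ (reach? B x)

    ∈component⁻ : ∀ {B x v} → v ∈ᵇ component B x → Reach B x v
    ∈component⁻ {B} {x} = ∈⟦⟧⁻ (reach? B x)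

    ∉component⁺ : ∀ {B x v} → ¬ Reach B x v → component B x v ≡ false
    ∉component⁺ {B} {x} = ∉⟦⟧⁺ (reach? B x)

  component⊆ : ∀ {B y} → component B y ⊆ᵇ B
  component⊆ = walk-target ∘ proj₂ ∘ ∈component⁻

  -- The least vertex of the component of y (junk value y when y ∉ B).
  representative : VSet → V → V
  representative B y = maybe′ (λ r → r) y (firstTrue (component B y))

  reach-representative : ∀ {B y} → y ∈ᵇ B → Reach B y (representative B y)
  reach-representative {B} {y} y∈B
    with firstTrue-just (component B y) y (∈component⁺ (0 , stop y∈B))
  ... | r , first≡r , r∈C rewrite first≡r = ∈component⁻ r∈C

  representative-~ : ∀ {B u v} → u ∈ᵇ B → v ∈ᵇ B → u ~ v → representative B u ≡ representative B v
  representative-~ {B} {u} {v} u∈B v∈B u~v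
    with firstTrue-just (component B u) u (∈component⁺ (0 , stop u∈B))
  ... | r , first≡r , _ =
    trans (cong (maybe′ (λ r → r) u) first≡r)
          (sym (cong (maybe′ (λ r → r) v) (trans (sym (firstTrue-cong same-component)) first≡r)))
    where
    u→v : Reach B u v
    u→v = 1 , step u∈B u~v (stop v∈B)
    same-component : ∀ w → component B u w ≡ component B v w
    same-component w with reach? B u w
    ... | yes u→w = trans (∈component⁺ u→w)
                          (sym (∈component⁺ (reach-trans (reach-sym u→v) u→w)))
    ... | no ¬u→w = trans (∉component⁺ ¬u→w)
                          (sym (∉component⁺ (¬u→w ∘ reach-trans u→v)))

  colouring-from-components : ∀ {B c} → (∀ y → Colouring (component B y) c) → Colouring B c
  colouring-from-components {B} {c} colour = f , bound , proper
    where
    f : V → ℕ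
    f v = proj₁ (colour (representative B v)) v
    ∈own-component : ∀ {v} → v ∈ᵇ B → v ∈ᵇ component B (representative B v)
    ∈own-component v∈B = ∈component⁺ (reach-sym (reach-representative v∈B))
    bound : ∀ {v} → v ∈ᵇ B → f v < c
    bound v∈B = proj₁ (proj₂ (colour _)) (∈own-component v∈B)
    proper : ∀ {u v} → u ∈ᵇ B → v ∈ᵇ B → u ~ v → f u ≢ f v
    proper {u} {v} u∈B v∈B u~v fu≡fv =
      proj₂ (proj₂ (colour (representative B v)))
        (subst (λ r → u ∈ᵇ component B r) same (∈own-component u∈B)) (∈own-component v∈B) u~v
        (trans (cong (λ r → proj₁ (colour r) u) (sym same)) fu≡fv)
      where
      same = representative-~ u∈B v∈B u~v

  opaque
    uncolourable-component : ∀ {B c} → ¬ Colouring B c → Σ V λ y → y ∈ᵇ B × ¬ Colouring (component B y) c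
    uncolourable-component {B} {c} ¬col with all? (λ y → colouring? (component B y) c)
    ... | yes col = ⊥-elim (¬col (colouring-from-components col))
    ... | no ¬all with ¬∀⟶∃¬ size _ (λ y → colouring? (component B y) c) ¬all
    ...   | y , ¬col-y with y ∈ᵇ? B
    ...     | yes y∈B = y , y∈B , ¬col-y
    ...     | no  y∉B = ⊥-elim (¬col-y (colouring-∅ λ v v∈C →
                          y∉B (walk-source (proj₂ (∈component⁻ v∈C)))))

  cycle-sym : ∀ {m} {i j : Fin m} → CycAdj G m i j → CycAdj G m j i
  cycle-sym (inj₁ e)                = inj₂ (inj₁ e)
  cycle-sym (inj₂ (inj₁ e))         = inj₁ e
  cycle-sym (inj₂ (inj₂ (inj₁ e))) = inj₂ (inj₂ (inj₂ e))
  cycle-sym (inj₂ (inj₂ (inj₂ e))) = inj₂ (inj₂ (inj₁ e))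

  hole-from-path : ∀ u y₀ mid yₗ → let ys = y₀ ∷ mid ∷ʳ yₗ in
    InducedPath ys → All (u ≢_) ys → u ~ y₀ → u ~ yₗ → All (λ v → ¬ u ~ v) mid → 1 ≤ length mid →
    Hole G (suc (length ys))
  hole-from-path u y₀ mid yₗ ip u∉ys u~y₀ u~yₗ u≁mid 1≤mid = record
    { atLeast4 = 4≤m ; vert = vert ; inj = injective ; induced-cycle = induced }
    where
    ys = y₀ ∷ mid ∷ʳ yₗ
    n = length ys
    m = suc n
    n≡ : n ≡ suc (suc (length mid))
    n≡ = cong suc (length-∷ʳ mid yₗ)
    4≤m : 4 ≤ m
    4≤m = subst (4 ≤_) (sym (cong suc n≡)) (s≤s (s≤s (s≤s 1≤mid)))
    vert : Fin m → V
    vert = lookup (u ∷ ys)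
    injective : ∀ i j → vert i ≡ vert j → i ≡ j
    injective fzero    fzero    _ = refl
    injective fzero    (fsuc j) e = ⊥-elim (all-lookup u∉ys j e)
    injective (fsuc i) fzero    e = ⊥-elim (all-lookup u∉ys i (sym e))
    injective (fsuc i) (fsuc j) e = cong fsuc (ip-lookup-injective ip i j e)
    end : Fin n → Set
    end j = toℕ j ≡ 0 ⊎ suc (toℕ j) ≡ n
    ~⇒end : ∀ j → u ~ lookup ys j → end j
    ~⇒end fzero    _   = inj₁ refl
    ~⇒end (fsuc k) u~y = inj₂ (cong suc (trans (cong suc (all-∷ʳ-lookup mid yₗ k u≁mid (λ f → f u~y)))
                                               (suc-injective (sym n≡))))
    end⇒~ : ∀ j → end j → u ~ lookup ys j
    end⇒~ fzero    _        = u~y₀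
    end⇒~ (fsuc k) (inj₂ e) =
      subst (u ~_) (sym (lookup-∷ʳ-last mid yₗ k (suc-injective (suc-injective (trans e n≡))))) u~yₗ
    induced : ∀ i j → (vert i ~ vert j → CycAdj G m i j) × (CycAdj G m i j → vert i ~ vert j)
    induced fzero fzero = ⊥-elim ∘ ~-irrefl , λ
      { (inj₂ (inj₂ (inj₁ (_ , 1≡m)))) → ⊥-elim (<-irrefl 1≡m (≤-trans (s≤s (s≤s z≤n)) 4≤m))
      ; (inj₂ (inj₂ (inj₂ (_ , 1≡m)))) → ⊥-elim (<-irrefl 1≡m (≤-trans (s≤s (s≤s z≤n)) 4≤m)) }
    induced fzero (fsuc j) = to , from
      where
      to : u ~ lookup ys j → CycAdj G m fzero (fsuc j)
      to u~y with ~⇒end j u~y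
      ... | inj₁ e = inj₁ (cong suc (sym e))
      ... | inj₂ e = inj₂ (inj₂ (inj₁ (refl , cong suc e)))
      from : CycAdj G m fzero (fsuc j) → u ~ lookup ys j
      from (inj₁ e)                     = end⇒~ j (inj₁ (sym (suc-injective e)))
      from (inj₂ (inj₂ (inj₁ (_ , e)))) = end⇒~ j (inj₂ (suc-injective e))
    induced (fsuc i) fzero = cycle-sym ∘ proj₁ (induced fzero (fsuc i)) ∘ ~-sym ,
                             ~-sym ∘ proj₂ (induced fzero (fsuc i)) ∘ cycle-sym
    induced (fsuc i) (fsuc j) with <-cmp (toℕ i) (toℕ j)
    ... | tri< i<j _ _ = (λ y~y′ → inj₁ (cong suc (ip-lookup-~ ip i j i<j y~y′))) , λ
      { (inj₁ e)        → ip-consecutive-~ ip i j (suc-injective e)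
      ; (inj₂ (inj₁ e)) → ⊥-elim (<-asym i<j (≤-reflexive (suc-injective e)))
      ; (inj₂ (inj₂ (inj₁ (() , _)))) ; (inj₂ (inj₂ (inj₂ (() , _)))) }
    ... | tri> _ _ j<i = (λ y~y′ → inj₂ (inj₁ (cong suc (ip-lookup-~ ip j i j<i (~-sym y~y′))))) , λ
      { (inj₂ (inj₁ e)) → ~-sym (ip-consecutive-~ ip j i (suc-injective e))
      ; (inj₁ e)        → ⊥-elim (<-asym j<i (≤-reflexive (suc-injective e)))
      ; (inj₂ (inj₂ (inj₁ (() , _)))) ; (inj₂ (inj₂ (inj₂ (() , _)))) }
    ... | tri≈ _ i≡j _ with toℕ-injective i≡j
    ...   | refl = ⊥-elim ∘ ~-irrefl , λ
      { (inj₁ e) → ⊥-elim (1+n≢n e) ; (inj₂ (inj₁ e)) → ⊥-elim (1+n≢n e)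
      ; (inj₂ (inj₂ (inj₁ (() , _)))) ; (inj₂ (inj₂ (inj₂ (() , _)))) }

  -- Breadth-first layers

  module BreadthFirst (S : VSet) (z : V) where

    opaque
      depth : V → ℕ
      depth v = proj₁ (least (λ k → walk? S k z v) size)

      depth-shortest : ∀ {v} → Reach S z v → Walk S z v (depth v) × ShortestWalkLength S z v (depth v)
      depth-shortest {v} r with least (λ k → walk? S k z v) size | reach-bounded r
      ... | _ , _ , shortest , inj₁ w    | _            = w , shortest
      ... | _ , _ , shortest , inj₂ refl | k , k<n , w = ⊥-elim (shortest k k<n w)

    depth-≤ : ∀ {v k} → Walk S z v k → depth v ≤ k
    depth-≤ {v} {k} w with depth v ≤? k
    ... | yes d≤k = d≤k
    ... | no  d≰k = ⊥-elim (proj₂ (depth-shortest (k , w)) k (≰⇒> d≰k) w)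

    depth-zero : ∀ {v} → Reach S z v → depth v ≡ 0 → z ≡ v
    depth-zero z→v d≡0 with subst (Walk S z _) d≡0 (proj₁ (depth-shortest z→v))
    ... | stop _ = refl

    depth-~ : ∀ {u v} → v ∈ᵇ S → u ~ v → Reach S z u → Reach S z v × depth v ≤ suc (depth u)
    depth-~ v∈S u~v z→u with depth-shortest z→u
    ... | w , _ = (_ , w ∷ʳʷ (u~v , v∈S)) , depth-≤ (w ∷ʳʷ (u~v , v∈S))

    opaque
      parent : ∀ {v t} → Reach S z v → depth v ≡ suc t → Σ V λ p → p ~ v × Reach S z p × depth p ≡ t
      parent {v} {t} z→v d≡ with depth-shortest z→v
      ... | w , shortest with initʷ (subst (Walk S z v) d≡ w)
      ...   | p , w′ , p~v with m≤n⇒m<n∨m≡n (depth-≤ w′)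
      ...     | inj₂ d≡t = p , p~v , (t , w′) , d≡t
      ...     | inj₁ d<t = ⊥-elim (shortest (suc (depth p)) (subst (suc (depth p) <_) (sym d≡) (s≤s d<t))
                                           (proj₁ (depth-shortest (t , w′)) ∷ʳʷ (p~v , walk-target w)))

    opaque
      layer : ℕ → VSet
      layer i = ⟦ (λ v → reach? S z v ×-dec (depth v ≟ i)) ⟧

      ∈layer⁺ : ∀ {i v} → Reach S z v → depth v ≡ i → v ∈ᵇ layer i
      ∈layer⁺ z→v d≡i = ∈⟦⟧⁺ (λ v → reach? S z v ×-dec (depth v ≟ _)) (z→v , d≡i)

      ∈layer⁻ : ∀ {i v} → v ∈ᵇ layer i → Reach S z v × depth v ≡ i
      ∈layer⁻ = ∈⟦⟧⁻ (λ v → reach? S z v ×-dec (depth v ≟ _))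

    layer⊆S : ∀ {i} → layer i ⊆ᵇ S
    layer⊆S = walk-target ∘ proj₂ ∘ proj₁ ∘ ∈layer⁻

    layer-apart : ∀ {a x w} → x ∈ᵇ layer (suc (suc a)) → Reach S z w → depth w ≤ a → Apart x w
    layer-apart {a} {x} {w} x∈L z→w d≤a with ∈layer⁻ x∈L
    ... | z→x , d≡ = (λ { refl → <-irrefl refl (≤-trans (n≤1+n _) (≤-trans (≤-reflexive (sym d≡)) d≤a)) }) ,
                      (λ x~w → <-irrefl refl (≤-trans (≤-reflexive (sym d≡))
                                 (≤-trans (proj₂ (depth-~ (walk-target (proj₂ z→x)) (~-sym x~w) z→w)) (s≤s d≤a))))

  -- Colouring graphs without long holes

  opaque
    insert : VSet → V → VSet
    insert B x = ⟦ (λ v → v ∈ᵇ? B ⊎-dec v ≟ᶠ x) ⟧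

    ∈insert-old : ∀ {B x v} → v ∈ᵇ B → v ∈ᵇ insert B x
    ∈insert-old {B} {x} = ∈⟦⟧⁺ (λ v → v ∈ᵇ? B ⊎-dec v ≟ᶠ x) ∘ inj₁

    ∈insert-new : ∀ {B x} → x ∈ᵇ insert B x
    ∈insert-new {B} {x} = ∈⟦⟧⁺ (λ v → v ∈ᵇ? B ⊎-dec v ≟ᶠ x) (inj₂ refl)

    ∈insert⁻ : ∀ {B x v} → v ∈ᵇ insert B x → v ∈ᵇ B ⊎ v ≡ x
    ∈insert⁻ {B} {x} = ∈⟦⟧⁻ (λ v → v ∈ᵇ? B ⊎-dec v ≟ᶠ x)

    _∖_ : VSet → VSet → VSet
    B ∖ A = ⟦ (λ v → v ∈ᵇ? B ×-dec ¬? (v ∈ᵇ? A)) ⟧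

    ∈∖⁺ : ∀ {A B v} → v ∈ᵇ B → ¬ v ∈ᵇ A → v ∈ᵇ B ∖ A
    ∈∖⁺ {A} {B} v∈B v∉A = ∈⟦⟧⁺ (λ v → v ∈ᵇ? B ×-dec ¬? (v ∈ᵇ? A)) (v∈B , v∉A)

    ∈∖⁻ : ∀ {A B v} → v ∈ᵇ B ∖ A → v ∈ᵇ B × ¬ v ∈ᵇ A
    ∈∖⁻ {A} {B} = ∈⟦⟧⁻ (λ v → v ∈ᵇ? B ×-dec ¬? (v ∈ᵇ? A))

  ∈∖-split : ∀ {A B v} → v ∈ᵇ B → v ∈ᵇ A ⊎ v ∈ᵇ B ∖ A
  ∈∖-split {A} {B} {v} v∈B = Sum.map₂ (∈∖⁺ {A} {B} v∈B) (toSum (v ∈ᵇ? A))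

  colouring-⋃ : ∀ {I : Set} {c} (F : I → VSet) (is : List I) → All (λ i → Colouring (F i) c) is →
                ∀ {B} → (∀ {v} → v ∈ᵇ B → Any (λ i → v ∈ᵇ F i) is) → Colouring B (length is * c)
  colouring-⋃ F []       []                     cover = colouring-∅ λ _ v∈B → case cover v∈B of λ ()
  colouring-⋃ F (i ∷ is) (colour-Fi ∷ colour-Fis) {B} cover =
    colouring-∪ colour-Fi (colouring-⋃ F is colour-Fis rest) ∈∖-split
    where
    rest : ∀ {v} → v ∈ᵇ B ∖ F i → Any (λ i → v ∈ᵇ F i) is
    rest v∈B∖Fi with ∈∖⁻ v∈B∖Fi
    ... | v∈B , v∉Fi with cover v∈B
    ...   | here v∈Fi  = ⊥-elim (v∉Fi v∈Fi)
    ...   | there v∈Fs = v∈Fs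

  uncolourable-∖ : ∀ {A B x y} → Colouring A x → ¬ Colouring B (x + y) → ¬ Colouring (B ∖ A) y
  uncolourable-∖ {A} {B} colour-A ¬colour-B colour-B∖A =
    ¬colour-B (colouring-∪ colour-A colour-B∖A ∈∖-split)

  opaque
    walk-exit : ∀ {A B y s k} → Walk A y s k → y ∈ᵇ B → ¬ s ∈ᵇ B →
                Σ V λ x → Σ V λ x′ → x ∈ᵇ A × ¬ x ∈ᵇ B × x ~ x′ × Reach B x′ y
    walk-exit (stop _) y∈B s∉B = ⊥-elim (s∉B y∈B)
    walk-exit {B = B} (step y∈A y~y₁ w) y∈B s∉B with _ ∈ᵇ? B
    ... | no  y₁∉B = _ , _ , walk-source w , y₁∉B , ~-sym y~y₁ , (0 , stop y∈B)
    ... | yes y₁∈B with walk-exit w y₁∈B s∉B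
    ...   | x , x′ , x∈A , x∉B , x~x′ , x′→y₁ =
      x , x′ , x∈A , x∉B , x~x′ , reach-trans x′→y₁ (1 , step y₁∈B (~-sym y~y₁) (stop y∈B))

  InN² : VSet → V → V → Set
  InN² S x v = v ∈ᵇ S × ¬ v ~ x × v ≢ x × Σ V λ u → u ∈ᵇ S × u ~ x × v ~ u

  opaque
    N¹ : VSet → V → VSet
    N¹ S x = ⟦ (λ v → v ∈ᵇ? S ×-dec v ~? x) ⟧

    N² : VSet → V → VSet
    N² S x = ⟦ (λ v → v ∈ᵇ? S ×-dec ¬? (v ~? x) ×-dec ¬? (v ≟ᶠ x) ×-dec
                       any? (λ u → u ∈ᵇ? S ×-dec u ~? x ×-dec v ~? u)) ⟧

    ∈N¹⁺ : ∀ {S x v} → v ∈ᵇ S → v ~ x → v ∈ᵇ N¹ S x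
    ∈N¹⁺ {S} {x} v∈S v~x = ∈⟦⟧⁺ (λ v → v ∈ᵇ? S ×-dec v ~? x) (v∈S , v~x)

    ∈N¹⁻ : ∀ {S x v} → v ∈ᵇ N¹ S x → v ∈ᵇ S × v ~ x
    ∈N¹⁻ {S} {x} = ∈⟦⟧⁻ (λ v → v ∈ᵇ? S ×-dec v ~? x)

    ∈N²⁺ : ∀ {S x v} → InN² S x v → v ∈ᵇ N² S x
    ∈N²⁺ {S} {x} = ∈⟦⟧⁺ (λ v → v ∈ᵇ? S ×-dec ¬? (v ~? x) ×-dec ¬? (v ≟ᶠ x) ×-dec
                                any? (λ u → u ∈ᵇ? S ×-dec u ~? x ×-dec v ~? u))

    ∈N²⁻ : ∀ {S x v} → v ∈ᵇ N² S x → InN² S x v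
    ∈N²⁻ {S} {x} = ∈⟦⟧⁻ (λ v → v ∈ᵇ? S ×-dec ¬? (v ~? x) ×-dec ¬? (v ≟ᶠ x) ×-dec
                                any? (λ u → u ∈ᵇ? S ×-dec u ~? x ×-dec v ~? u))


  apart-via-N² : ∀ {S d q} ys → d ∈ᵇ S → q ∈ᵇ S → q ~ d → All (λ y → ¬ d ∈ᵇ N² S y) ys →
                 All (λ y → Apart y d) ys → All (Apart q) ys
  apart-via-N² ys d∈S q∈S q~d d∉N² ys-apart-d = All.zipWith
    (λ (d∉N²y , y≢d , y≁d) → (λ { refl → y≁d q~d }) ,
       (λ q~y → d∉N²y (∈N²⁺ (d∈S , y≁d ∘ ~-sym , y≢d ∘ sym , _ , q∈S , q~y , ~-sym q~d))))
    (d∉N² , ys-apart-d)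

  induced-path-into : ∀ {B v d} → ¬ v ∈ᵇ B → d ∈ᵇ B → Reach (insert B v) v d →
                      Σ (List V) λ mid → InducedPath (v ∷ mid ∷ʳ d) × All (_∈ᵇ B) (mid ∷ʳ d)
  induced-path-into {B} {v} {d} v∉B d∈B (_ , w) with shortest-walk w
  ... | _ , w′ , shortest with vertices-inner w′ (λ { refl → v∉B d∈B })
  ...   | mid , vertices≡ = mid , ip , All.zipWith in-B (All.tail in-B+v , ip-head-∉ ip)
    where
    ip : InducedPath (v ∷ mid ∷ʳ d)
    ip = subst InducedPath vertices≡ (shortest-walk-induced w′ shortest)
    in-B+v : All (_∈ᵇ insert B v) (v ∷ mid ∷ʳ d)
    in-B+v = subst (All (_∈ᵇ insert B v)) vertices≡ (vertices-∈ᵇ w′)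
    in-B : ∀ {t} → t ∈ᵇ insert B v × v ≢ t → t ∈ᵇ B
    in-B (t∈B+v , v≢t) = [ (λ t∈B → t∈B) , (λ t≡v → ⊥-elim (v≢t (sym t≡v))) ]′ (∈insert⁻ t∈B+v)

  module HoleFreeColouring (S : VSet) (L κ n : ℕ) (1≤L : 1 ≤ L) (noHole : NoHoleAtLeast G (L + 3))
    (χN¹ : ∀ {x} → x ∈ᵇ S → Colouring (N¹ S x) κ)
    (χN² : ∀ {x} → x ∈ᵇ S → Colouring (N² S x) n) where

    M : ℕ
    M = L * (κ + n)

    vertex-outside-N² : ∀ ys {D} → All (_∈ᵇ S) ys → ¬ Colouring D (length ys * n) →
                        Σ V λ d → d ∈ᵇ D × All (λ y → ¬ d ∈ᵇ N² S y) ys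
    vertex-outside-N² ys {D} ys⊆S ¬colour
      with all? (λ d → d ∈ᵇ? D →-dec Any.any? (λ y → d ∈ᵇ? N² S y) ys)
    ... | yes covered = ⊥-elim (¬colour (colouring-⋃ (N² S) ys (All.map χN² ys⊆S) (covered _)))
    ... | no ¬covered with ¬∀⟶∃¬ size _ (λ d → d ∈ᵇ? D →-dec Any.any? (λ y → d ∈ᵇ? N² S y) ys) ¬covered
    ...   | d , ¬d-covered with d ∈ᵇ? D
    ...     | no  d∉D = ⊥-elim (¬d-covered (⊥-elim ∘ d∉D))
    ...     | yes d∈D = d , d∈D , All.¬Any⇒All¬ ys (¬d-covered ∘ const)

    module Gyárfás (z : V) (a : ℕ) where
      open BreadthFirst S z

      outer : VSet
      outer = layer (suc (suc a))

      budget : ℕ → ℕ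
      budget j = (L ∸ j) * κ + L * n

      budget-suc : ∀ {j} → j < L → budget j ≡ κ + budget (suc j)
      budget-suc {j} j<L = trans (cong (λ r → r * κ + L * n) (+-∸-assoc 1 j<L)) (+-assoc κ _ _)

      budget-exhausted : budget L ≡ L * n
      budget-exhausted = cong (λ r → r * κ + L * n) (n∸n≡0 L)

      -- After j steps the induced path runs from p at depth a + 1 into the layer of depth a + 2,
      -- and the set D hanging from its end is still not budget j colourable: each step moves
      -- the end into N¹ of the old end, which costs κ colours.
      record GyárfásPath (p : V) (j : ℕ) : Set where
        field
          p-reach     : Reach S z p
          p-depth     : depth p ≡ suc a
          init        : List V
          end         : V
          tail        : List V
          from-p      : init ∷ʳ end ≡ p ∷ tail
          length-init : length init ≡ j
          induced     : InducedPath (init ∷ʳ end)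
          path⊆S      : All (_∈ᵇ S) (init ∷ʳ end)
          tail⊆outer  : All (_∈ᵇ outer) tail
          D           : VSet
          D⊆outer     : D ⊆ᵇ outer
          path∉D      : All (λ x → ¬ x ∈ᵇ D) (init ∷ʳ end)
          init≁D      : All (λ x → ∀ w → w ∈ᵇ D → ¬ x ~ w) init
          D-from-end  : ∀ {w} → w ∈ᵇ D → Reach (insert D end) end w
          D-uncolourable : ¬ Colouring D (budget j)

      hangs-from : ∀ {B y x x′} → x ~ x′ → Reach B y x′ →
                   ∀ {w} → w ∈ᵇ component B y → Reach (insert (component B y) x) x w
      hangs-from {B} {y} x~x′ y→x′ w∈K with reach-trans (reach-sym y→x′) (∈component⁻ w∈K)
      ... | _ , x′→w = _ , step ∈insert-new x~x′ (restrictʷ x′→w (All.tabulate λ u∈w →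
                        ∈insert-old (∈component⁺ (reach-trans y→x′ (_ , proj₂ (proj₂ (prefixʷ x′→w u∈w)))))))

      start : ¬ Colouring outer M → Σ V λ p → GyárfásPath p 0
      start ¬colour with uncolourable-component ¬colour
      ... | y , y∈outer , ¬colour-K with ∈layer⁻ y∈outer
      ...   | z→y , depth-y with parent z→y depth-y
      ...     | p , p~y , z→p , depth-p = p , record
        { p-reach = z→p ; p-depth = depth-p ; init = [] ; end = p ; tail = [] ; from-p = refl
        ; length-init = refl ; induced = tt ; path⊆S = walk-target (proj₂ z→p) ∷ [] ; tail⊆outer = []
        ; D = component outer y ; D⊆outer = component⊆ ; path∉D = p∉K ∷ [] ; init≁D = []
        ; D-from-end = hangs-from p~y (0 , stop y∈outer)
        ; D-uncolourable = ¬colour-K ∘ subst (Colouring _) (sym (*-distribˡ-+ L κ n)) }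
        where
        p∉K : ¬ p ∈ᵇ component outer y
        p∉K p∈K = 1+n≢n (trans (sym (proj₂ (∈layer⁻ (component⊆ p∈K)))) depth-p)

      extend : ∀ {p j} → j < L → GyárfásPath p j → GyárfásPath p (suc j)
      extend {p} {j} j<L γ = next (uncolourable-component ¬colour-B)
        where
        open GyárfásPath γ
        B : VSet
        B = D ∖ N¹ S end
        end∈S : end ∈ᵇ S
        end∈S = all-last init path⊆S
        ¬colour-B : ¬ Colouring B (budget (suc j))
        ¬colour-B = uncolourable-∖ (χN¹ end∈S) (D-uncolourable ∘ subst (Colouring D) (sym (budget-suc j<L)))
        B-≁end : ∀ {w} → w ∈ᵇ B → ¬ w ~ end
        B-≁end w∈B w~end with ∈∖⁻ w∈B
        ... | w∈D , w∉N¹ = w∉N¹ (∈N¹⁺ (layer⊆S (D⊆outer w∈D)) w~end)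
        next : Σ V (λ y → y ∈ᵇ B × ¬ Colouring (component B y) (budget (suc j))) → GyárfásPath p (suc j)
        next (y , y∈B , ¬colour-K) with walk-exit (reverseʷ (proj₂ (D-from-end (proj₁ (∈∖⁻ y∈B))))) y∈B
                                                 (all-last init path∉D ∘ proj₁ ∘ ∈∖⁻)
        ... | x , x′ , x∈D+end , x∉B , x~x′ , x′→y = record
          { p-reach = p-reach ; p-depth = p-depth ; init = init ∷ʳ end ; end = x ; tail = tail ∷ʳ x
          ; from-p = cong (_∷ʳ x) from-p
          ; length-init = trans (length-∷ʳ init end) (cong suc length-init)
          ; induced = subst InducedPath (sym (++-assoc init (end ∷ []) (x ∷ [])))
                        (ip-++⁺ init end (x ∷ []) induced (~-sym x~end , [] , tt) init-apart-x)
          ; path⊆S = All.++⁺ path⊆S (layer⊆S x∈outer ∷ [])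
          ; tail⊆outer = All.++⁺ tail⊆outer (x∈outer ∷ [])
          ; D = K ; D⊆outer = D⊆outer ∘ K⊆D
          ; path∉D = All.++⁺ (All.map (_∘ K⊆D) path∉D) (x∉B ∘ component⊆ ∷ [])
          ; init≁D = All.++⁺ (All.map (λ ≁D w → ≁D w ∘ K⊆D) init≁D)
                             ((λ w w∈K → B-≁end (component⊆ w∈K) ∘ ~-sym) ∷ [])
          ; D-from-end = hangs-from x~x′ (reach-sym x′→y)
          ; D-uncolourable = ¬colour-K }
          where
          K : VSet
          K = component B y
          K⊆D : K ⊆ᵇ D
          K⊆D = proj₁ ∘ ∈∖⁻ ∘ component⊆
          x∈D : x ∈ᵇ D
          x∈D with ∈insert⁻ x∈D+end
          ... | inj₁ x∈D = x∈D
          ... | inj₂ refl = ⊥-elim (B-≁end (walk-source (proj₂ x′→y)) (~-sym x~x′))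
          x~end : x ~ end
          x~end with x ∈ᵇ? N¹ S end
          ... | yes x∈N¹ = proj₂ (∈N¹⁻ x∈N¹)
          ... | no  x∉N¹ = ⊥-elim (x∉B (∈∖⁺ x∈D x∉N¹))
          x∈outer : x ∈ᵇ outer
          x∈outer = D⊆outer x∈D
          init-apart-x : All (λ u → All (Apart u) (x ∷ [])) init
          init-apart-x = All.zipWith (λ (u∉D , u≁D) → ((λ { refl → u∉D x∈D }) , u≁D x x∈D) ∷ [])
                                     (All.++⁻ˡ init path∉D , init≁D)

      Shallow : V → Set
      Shallow w = Reach S z w × depth w ≤ a

      Shallow? : ∀ w → Dec (Shallow w)
      Shallow? w = reach? S z w ×-dec depth w ≤? a

      ShallowOr : V → V → V → Set
      ShallowOr p q w = Shallow w ⊎ w ≡ p ⊎ w ≡ q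

      opaque
        shallow∪ : V → V → VSet
        shallow∪ p q = ⟦ (λ w → Shallow? w ⊎-dec (w ≟ᶠ p ⊎-dec w ≟ᶠ q)) ⟧

        ∈shallow∪⁺ : ∀ {p q w} → ShallowOr p q w → w ∈ᵇ shallow∪ p q
        ∈shallow∪⁺ {p} {q} = ∈⟦⟧⁺ (λ w → Shallow? w ⊎-dec (w ≟ᶠ p ⊎-dec w ≟ᶠ q))

        ∈shallow∪⁻ : ∀ {p q w} → w ∈ᵇ shallow∪ p q → ShallowOr p q w
        ∈shallow∪⁻ {p} {q} = ∈⟦⟧⁻ (λ w → Shallow? w ⊎-dec (w ≟ᶠ p ⊎-dec w ≟ᶠ q))

      shallow-walk : ∀ {B t k} (w : Walk S z t k) → k ≤ a → (∀ {u} → Shallow u → u ∈ᵇ B) → Walk B z t k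
      shallow-walk w k≤a ⊆B = restrictʷ w (All.tabulate λ u∈w → case prefixʷ w u∈w of λ
        (k′ , k′≤k , w′) → ⊆B ((k′ , w′) , ≤-trans (depth-≤ w′) (≤-trans k′≤k k≤a)))

      -- Up from q to depth a, across the shallow part, and down again to p.
      upper-walk : ∀ {p q} → Reach S z p → depth p ≡ suc a → Reach S z q → depth q ≡ suc a →
                   Reach (shallow∪ p q) q p
      upper-walk {p} {q} z→p depth-p z→q depth-q with parent z→p depth-p | parent z→q depth-q
      ... | p′ , p′~p , z→p′ , depth-p′ | q′ , q′~q , z→q′ , depth-q′ =
        _ , step (∈shallow∪⁺ (inj₂ (inj₂ refl))) (~-sym q′~q)
              (reverseʷ (down z→q′ depth-q′) ++ʷ
                 (down z→p′ depth-p′ ∷ʳʷ (p′~p , ∈shallow∪⁺ (inj₂ (inj₁ refl)))))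
        where
        down : ∀ {t} → Reach S z t → depth t ≡ a → Walk (shallow∪ p q) z t (depth t)
        down z→t depth-t = shallow-walk (proj₁ (depth-shortest z→t)) (≤-reflexive depth-t) (∈shallow∪⁺ ∘ inj₁)

      opaque
        upper-path : ∀ {p q} → Reach S z p → depth p ≡ suc a → Reach S z q → depth q ≡ suc a → q ≢ p →
                     Σ (List V) λ mid → InducedPath (q ∷ mid ∷ʳ p) × All Shallow mid
        upper-path {p} {q} z→p depth-p z→q depth-q q≢p
          with shortest-walk (proj₂ (upper-walk z→p depth-p z→q depth-q))
        ... | _ , w , shortest with vertices-inner w q≢p
        ...   | mid , vertices≡ = mid , ip , mid-shallow
          where
          ip : InducedPath (q ∷ mid ∷ʳ p)
          ip = subst InducedPath vertices≡ (shortest-walk-induced w shortest)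
          shallow : ∀ {t} → t ∈ᵇ shallow∪ p q → q ≢ t → t ≢ p → Shallow t
          shallow t∈U q≢t t≢p with ∈shallow∪⁻ t∈U
          ... | inj₁ t-shallow      = t-shallow
          ... | inj₂ (inj₁ t≡p) = ⊥-elim (t≢p t≡p)
          ... | inj₂ (inj₂ t≡q) = ⊥-elim (q≢t (sym t≡q))
          mid-shallow : All Shallow mid
          mid-shallow = All.zipWith (λ (t∈U , q≢t , t≢p) → shallow t∈U q≢t t≢p)
            (All.++⁻ˡ mid (All.tail (subst (All (_∈ᵇ shallow∪ p q)) vertices≡ (vertices-∈ᵇ w))) ,
             All.zip (All.++⁻ˡ mid (ip-head-∉ ip) , All.tail (ip-last-∉ (q ∷ mid) p ip)))

      -- The hole runs through p, T, b, q, up′, pₗ and back to p.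
      hole-via-upper-path : ∀ {p q b y₀ pₗ} T T′ up′ → T ∷ʳ b ≡ y₀ ∷ T′ →
        InducedPath (p ∷ T ∷ʳ b) → All (_∈ᵇ outer) (T ∷ʳ b) → q ~ b → All (Apart q) (p ∷ T) →
        InducedPath (q ∷ (up′ ∷ʳ pₗ) ∷ʳ p) → All Shallow (up′ ∷ʳ pₗ) →
        Σ ℕ λ m → length T + 4 ≤ m × Hole G m
      hole-via-upper-path {p} {q} {b} {y₀} {pₗ} T T′ up′ Tb≡ ip-pTb Tb⊆outer q~b q-apart ip-up up-shallow =
        _ , length-bound , hole-from-path p y₀ mid pₗ
          (subst InducedPath ys≡ ip-ys) (subst (All (p ≢_)) ys≡ p∉ys) p~y₀ p~pₗ p≁mid 1≤mid
        where
        mid = T′ ++ q ∷ up′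
        ys≡ : (T ∷ʳ b) ++ q ∷ (up′ ∷ʳ pₗ) ≡ y₀ ∷ mid ∷ʳ pₗ
        ys≡ = trans (cong (_++ q ∷ (up′ ∷ʳ pₗ)) Tb≡) (cong (y₀ ∷_) (sym (++-assoc T′ (q ∷ up′) (pₗ ∷ []))))
        ip-p-y₀ : InducedPath (p ∷ y₀ ∷ T′)
        ip-p-y₀ = subst (InducedPath ∘ (p ∷_)) Tb≡ ip-pTb
        ip-up′ : InducedPath ((q ∷ up′) ++ pₗ ∷ p ∷ [])
        ip-up′ = subst (InducedPath ∘ (q ∷_)) (++-assoc up′ (pₗ ∷ []) (p ∷ [])) ip-up
        ip-Tbq : InducedPath ((T ∷ʳ b) ∷ʳ q)
        ip-Tbq = subst InducedPath (sym (++-assoc T (b ∷ []) (q ∷ [])))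
          (ip-++⁺ T b (q ∷ []) (ip-tail {p} {T ∷ʳ b} ip-pTb) (~-sym q~b , [] , tt)
            (All.map (λ (q≢x , q≁x) → (q≢x ∘ sym , q≁x ∘ ~-sym) ∷ []) (All.tail q-apart)))
        ip-ys : InducedPath ((T ∷ʳ b) ++ q ∷ (up′ ∷ʳ pₗ))
        ip-ys = ip-++⁺ (T ∷ʳ b) q (up′ ∷ʳ pₗ) ip-Tbq (ip-++⁻ˡ (q ∷ up′ ∷ʳ pₗ) (p ∷ []) ip-up)
          (All.map (λ x∈outer → All.map (λ (z→t , d≤a) → layer-apart x∈outer z→t d≤a) up-shallow) Tb⊆outer)
        p∉ys : All (p ≢_) ((T ∷ʳ b) ++ q ∷ (up′ ∷ʳ pₗ))
        p∉ys = All.++⁺ (ip-head-∉ ip-pTb)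
          ((proj₁ (All.head q-apart) ∘ sym) ∷ All.map (_∘ sym) (All.tail (ip-last-∉ (q ∷ up′ ∷ʳ pₗ) p ip-up)))
        p~y₀ : p ~ y₀
        p~y₀ = proj₁ ip-p-y₀
        p~pₗ : p ~ pₗ
        p~pₗ = ~-sym (ip-last-~ (q ∷ up′) pₗ p ip-up′)
        p≁mid : All (λ v → ¬ p ~ v) mid
        p≁mid = All.++⁺ (All.map proj₂ (proj₁ (proj₂ ip-p-y₀)))
          ((proj₂ (All.head q-apart) ∘ ~-sym) ∷ All.map (_∘ ~-sym) (All.tail (ip-last-≁ (q ∷ up′) pₗ p ip-up′)))
        1≤mid : 1 ≤ length mid
        1≤mid = subst (1 ≤_) (sym (length-++ T′)) (≤-trans (s≤s z≤n) (m≤n+m _ (length T′)))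
        length-bound : length T + 4 ≤ suc (length (y₀ ∷ mid ∷ʳ pₗ))
        length-bound = subst (λ ys → length T + 4 ≤ suc (length ys)) ys≡ (begin
          length T + 4                                      ≡⟨ +-comm (length T) 4 ⟩
          3 + suc (length T)                                ≤⟨ +-monoʳ-≤ 3 (m≤m+n (suc (length T)) (length up′)) ⟩
          3 + (suc (length T) + length up′)                 ≡⟨ cong (suc ∘ suc) (sym (trans (+-suc (length T) _)
                                                                (cong suc (+-suc (length T) (length up′))))) ⟩
          suc (suc (length T) + suc (suc (length up′)))     ≡⟨ cong suc (sym (cong₂ _+_ (length-∷ʳ T b)
                                                                (cong suc (length-∷ʳ up′ pₗ)))) ⟩
          suc (length (T ∷ʳ b) + length (q ∷ up′ ∷ʳ pₗ))    ≡⟨ cong suc (sym (length-++ (T ∷ʳ b))) ⟩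
          suc (length ((T ∷ʳ b) ++ q ∷ (up′ ∷ʳ pₗ)))        ∎)
          where open ≤-Reasoning

      closing-hole : ∀ {p q b} T → Reach S z p → depth p ≡ suc a → Reach S z q → depth q ≡ suc a →
        InducedPath (p ∷ T ∷ʳ b) → All (_∈ᵇ outer) (T ∷ʳ b) → q ~ b → All (Apart q) (p ∷ T) →
        Σ ℕ λ m → length T + 4 ≤ m × Hole G m
      closing-hole {p} {q} {b} T z→p depth-p z→q depth-q ip-pTb Tb⊆outer q~b q-apart
        with upper-path z→p depth-p z→q depth-q (proj₁ (All.head q-apart))
      ... | up , ip-up , up-shallow with initLast up
      ...   | [] = ⊥-elim (proj₂ (All.head q-apart) (proj₁ ip-up))
      ...   | up′ ∷ʳ′ pₗ with ∷ʳ-uncons T b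
      ...     | _ , T′ , Tb≡ = hole-via-upper-path T T′ up′ Tb≡
                             ip-pTb Tb⊆outer q~b q-apart ip-up up-shallow

      -- As d lies outside every N² S y, its parent q is apart from the path p ∷ X, which is then
      -- continued through D and closed through q.
      opaque
        long-path-closes-hole : ∀ {p v D} X → Reach S z p → depth p ≡ suc a →
          InducedPath (p ∷ X ∷ʳ v) → All (_∈ᵇ S) (p ∷ X) → All (_∈ᵇ outer) (X ∷ʳ v) →
          D ⊆ᵇ outer → All (λ x → ¬ x ∈ᵇ D) (p ∷ X ∷ʳ v) →
          All (λ x → ∀ w → w ∈ᵇ D → ¬ x ~ w) (p ∷ X) →
          (∀ {w} → w ∈ᵇ D → Reach (insert D v) v w) → ¬ Colouring D (length (p ∷ X) * n) →
          Σ ℕ λ m → length X + 4 ≤ m × Hole G m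
        long-path-closes-hole {p} {v} {D} X z→p depth-p ip pX⊆S Xv⊆outer D⊆outer path∉D pX≁D D-from-v ¬colour
          with vertex-outside-N² (p ∷ X) pX⊆S ¬colour
        ... | d , d∈D , d∉N² with induced-path-into (all-last (p ∷ X) path∉D) d∈D (D-from-v d∈D)
        ...   | ω , ip-ω , ω⊆D with ∈layer⁻ (D⊆outer d∈D)
        ...     | z→d , depth-d with parent z→d depth-d
        ...       | q , q~d , z→q , depth-q with split-at-first (q ~?_) (v ∷ ω) d q~d
        ...         | A , b , C , vω≡ , q≁A , q~b = Product.map₂ (Product.map₁ (≤-trans (+-monoˡ-≤ 4 X≤XA)))
                        (closing-hole (X ++ A) z→p depth-p z→q depth-q ip-pTb Tb⊆outer q~b (All.++⁺ q-apart-pX q-apart-A))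
          where
          X≤XA : length X ≤ length (X ++ A)
          X≤XA = subst (length X ≤_) (sym (length-++ X)) (m≤m+n (length X) (length A))
          path≡ : (p ∷ X) ++ v ∷ ω ∷ʳ d ≡ p ∷ ((X ++ A) ∷ʳ b) ++ C
          path≡ = cong (p ∷_) (begin
            X ++ (v ∷ ω ∷ʳ d)        ≡⟨ cong (X ++_) vω≡ ⟩
            X ++ A ++ b ∷ C          ≡⟨ sym (++-assoc X A (b ∷ C)) ⟩
            (X ++ A) ++ b ∷ C        ≡⟨ sym (++-assoc (X ++ A) (b ∷ []) C) ⟩
            ((X ++ A) ∷ʳ b) ++ C     ∎)
            where open ≡-Reasoning
          ip-path : InducedPath ((p ∷ X) ++ v ∷ ω ∷ʳ d)
          ip-path = ip-++⁺ (p ∷ X) v (ω ∷ʳ d) ip ip-ω (All.zipWith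
            (λ (x∉D , x≁D) → All.map (λ t∈D → (λ { refl → x∉D t∈D }) , x≁D _ t∈D) ω⊆D)
            (All.++⁻ˡ (p ∷ X) path∉D , pX≁D))
          ip-pTb : InducedPath (p ∷ (X ++ A) ∷ʳ b)
          ip-pTb = ip-++⁻ˡ (p ∷ (X ++ A) ∷ʳ b) C (subst InducedPath path≡ ip-path)
          vω⊆outer : All (_∈ᵇ outer) (A ++ b ∷ C)
          vω⊆outer = subst (All (_∈ᵇ outer)) vω≡ (all-last X Xv⊆outer ∷ All.map D⊆outer ω⊆D)
          Tb⊆outer : All (_∈ᵇ outer) ((X ++ A) ∷ʳ b)
          Tb⊆outer = All.++⁺ (All.++⁺ (All.++⁻ˡ X Xv⊆outer) (All.++⁻ˡ A vω⊆outer))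
                             (All.head (All.++⁻ʳ A vω⊆outer) ∷ [])
          q-apart-pX : All (Apart q) (p ∷ X)
          q-apart-pX = apart-via-N² (p ∷ X) (layer⊆S (D⊆outer d∈D)) (walk-target (proj₂ z→q)) q~d d∉N²
            (All.zipWith (λ (x∉D , x≁D) → (λ { refl → x∉D d∈D }) , x≁D d d∈D)
                         (All.++⁻ˡ (p ∷ X) path∉D , pX≁D))
          q-apart-A : All (Apart q) A
          q-apart-A = All.zipWith (λ (q≁t , t∈outer) →
              (λ { refl → 1+n≢n (trans (sym (proj₂ (∈layer⁻ t∈outer))) depth-q) }) , q≁t)
            (q≁A , All.++⁻ˡ A vω⊆outer)

      gyárfás-path-impossible : ∀ {p} → GyárfásPath p L → ⊥
      gyárfás-path-impossible record { init = [] ; length-init = L≡0 } = <-irrefl L≡0 1≤L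
      gyárfás-path-impossible record
        { p-reach = z→p ; p-depth = depth-p ; init = p ∷ X ; end = v ; from-p = refl ; length-init = length≡
        ; induced = ip ; path⊆S = path⊆S ; tail⊆outer = Xv⊆outer ; D⊆outer = D⊆outer ; path∉D = path∉D
        ; init≁D = pX≁D ; D-from-end = D-from-v ; D-uncolourable = ¬colour }
        with long-path-closes-hole X z→p depth-p ip (All.++⁻ˡ (p ∷ X) path⊆S) Xv⊆outer D⊆outer path∉D pX≁D
               D-from-v (¬colour ∘ subst (Colouring _) (trans (cong (_* n) length≡) (sym budget-exhausted)))
      ... | m , X+4≤m , hole = noHole m (subst (_≤ m) (trans (+-suc (length X) 3) (cong (_+ 3) length≡)) X+4≤m) hole

      grow : ∀ {p} j → j ≤ L → GyárfásPath p 0 → GyárfásPath p j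
      grow zero    _     γ = γ
      grow (suc j) j<L γ = extend j<L (grow j (<⇒≤ j<L) γ)

      layer-colouring : Colouring outer M
      layer-colouring with colouring? outer M
      ... | yes colour = colour
      ... | no ¬colour = ⊥-elim (gyárfás-path-impossible (grow L ≤-refl (proj₂ (start ¬colour))))

    parity : ℕ → Bool
    parity zero    = false
    parity (suc i) = not (parity i)

    -- Consecutive layers use the disjoint palettes [1, M] and [M + 1, 2M]; the root gets colour 0.
    shift : ℕ → ℕ
    shift i = if parity i then M else 0

    shift≤M : ∀ i → shift i ≤ M
    shift≤M i with parity i
    ... | true  = ≤-refl
    ... | false = z≤n

    shifts-apart : ∀ {x y} i → x < M → y < M → shift i + x ≢ shift (suc i) + y
    shifts-apart i x<M y<M with parity i
    ... | true  = λ M+x≡y → <-irrefl (sym M+x≡y) (≤-trans y<M (m≤m+n M _))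
    ... | false = λ x≡M+y → <-irrefl x≡M+y (≤-trans x<M (m≤m+n M _))

    κ≤M : κ ≤ M
    κ≤M = ≤-trans (m≤m+n κ n) (≤-trans (≤-reflexive (sym (*-identityˡ (κ + n)))) (*-monoˡ-≤ (κ + n) 1≤L))

    component-colouring : ∀ z → Colouring (component S z) (suc (M + M))
    component-colouring z = colour , bound , proper
      where
      open BreadthFirst S z
      open Gyárfás z
      first-layer : Colouring (layer 1) κ
      first-layer with z ∈ᵇ? S
      ... | yes z∈S = colouring-⊆ layer1⊆N¹ (χN¹ z∈S)
        where
        layer1⊆N¹ : layer 1 ⊆ᵇ N¹ S z
        layer1⊆N¹ v∈L₁ with ∈layer⁻ v∈L₁
        ... | z→v , depth-v with parent z→v depth-v
        ...   | p , p~v , z→p , depth-p with depth-zero z→p depth-p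
        ...     | refl = ∈N¹⁺ (walk-target (proj₂ z→v)) (~-sym p~v)
      ... | no z∉S = colouring-∅ λ v v∈L₁ → z∉S (walk-source (proj₂ (proj₁ (∈layer⁻ v∈L₁))))
      layer-colouring′ : ∀ i → Colouring (layer (suc i)) M
      layer-colouring′ zero    = colouring-mono κ≤M first-layer
      layer-colouring′ (suc a) = layer-colouring a
      in-palette : ∀ i {v} → v ∈ᵇ layer (suc i) → proj₁ (layer-colouring′ i) v < M
      in-palette i = proj₁ (proj₂ (layer-colouring′ i))
      paint : ℕ → V → ℕ
      paint zero    v = 0
      paint (suc i) v = suc (shift (suc i) + proj₁ (layer-colouring′ i) v)
      colour : V → ℕ
      colour v = paint (depth v) v
      bound : ∀ {v} → v ∈ᵇ component S z → colour v < suc (M + M)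
      bound {v} v∈K with depth v in depth-v
      ... | zero  = s≤s z≤n
      ... | suc i = s≤s (+-mono-≤-< (shift≤M (suc i)) (in-palette i (∈layer⁺ (∈component⁻ v∈K) depth-v)))
      paint-proper : ∀ i j {u v} → u ∈ᵇ layer i → v ∈ᵇ layer j → u ~ v → i ≤ suc j → j ≤ suc i →
                     paint i u ≢ paint j v
      paint-proper zero zero u∈L v∈L u~v _ _ _ with depth-zero (proj₁ (∈layer⁻ u∈L)) (proj₂ (∈layer⁻ u∈L))
                                                 | depth-zero (proj₁ (∈layer⁻ v∈L)) (proj₂ (∈layer⁻ v∈L))
      ... | refl | refl = ~-irrefl u~v
      paint-proper zero    (suc j) _ _ _ _ _ = λ ()
      paint-proper (suc i) zero    _ _ _ _ _ = λ ()
      paint-proper (suc i) (suc j) u∈L v∈L u~v i≤j+1 j≤i+1 with <-cmp i j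
      ... | tri≈ _ refl _ =
        proj₂ (proj₂ (layer-colouring′ i)) u∈L v∈L u~v ∘ +-cancelˡ-≡ (shift (suc i)) _ _ ∘ suc-injective
      ... | tri< i<j _ _ with ≤-antisym i<j (≤-pred j≤i+1)
      ...   | refl = shifts-apart (suc i) (in-palette i u∈L) (in-palette (suc i) v∈L) ∘ suc-injective
      paint-proper (suc i) (suc j) u∈L v∈L u~v i≤j+1 j≤i+1 | tri> _ _ j<i with ≤-antisym j<i (≤-pred i≤j+1)
      ...   | refl = shifts-apart (suc j) (in-palette j v∈L) (in-palette (suc j) u∈L) ∘ suc-injective ∘ sym
      proper : ∀ {u v} → u ∈ᵇ component S z → v ∈ᵇ component S z → u ~ v → colour u ≢ colour v
      proper u∈K v∈K u~v = paint-proper (depth _) (depth _)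
        (∈layer⁺ (∈component⁻ u∈K) refl) (∈layer⁺ (∈component⁻ v∈K) refl) u~v
        (proj₂ (depth-~ (component⊆ u∈K) (~-sym u~v) (∈component⁻ v∈K)))
        (proj₂ (depth-~ (component⊆ v∈K) u~v (∈component⁻ u∈K)))

    colouring : Colouring S (suc (M + M))
    colouring = colouring-from-components component-colouring

  -- The neighbourhoods N¹ and the reduction to N²

  -- G[B], on the whole vertex set of G: the vertices outside B become isolated.
  induced : VSet → Graph
  induced B = record
    { size   = size
    ; adj    = λ u v → (B u ∧ B v) ∧ adj u v
    ; sym    = λ u v → cong₂ _∧_ (∧-comm (B u) (B v)) (Graph.sym G u v)
    ; irrefl = λ v → trans (cong ((B v ∧ B v) ∧_) (Graph.irrefl G v)) (∧-zeroʳ (B v ∧ B v))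
    }

  induced-~⁻ : ∀ {B u v} → Adj (induced B) u v → u ∈ᵇ B × v ∈ᵇ B × u ~ v
  induced-~⁻ {B} {u} {v} e = ∧-conicalˡ (B u) (B v) B-edge , ∧-conicalʳ (B u) (B v) B-edge , ∧-conicalʳ _ (adj u v) e
    where
    B-edge : B u ∧ B v ≡ true
    B-edge = ∧-conicalˡ _ (adj u v) e

  induced-~⁺ : ∀ {B u v} → u ∈ᵇ B → v ∈ᵇ B → u ~ v → Adj (induced B) u v
  induced-~⁺ u∈B v∈B u~v rewrite u∈B | v∈B = u~v

  cycle-successor : ∀ {m} → 4 ≤ m → (i : Fin m) → Σ (Fin m) λ j → CycAdj G m i j
  cycle-successor {m} 4≤m i with suc (toℕ i) <? m
  ... | yes i+1<m = fromℕ< i+1<m , inj₁ (sym (toℕ-fromℕ< i+1<m))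
  ... | no  i+1≮m = fromℕ< 0<m , inj₂ (inj₂ (inj₂ (toℕ-fromℕ< 0<m , ≤-antisym (toℕ<n i) (≮⇒≥ i+1≮m))))
    where
    0<m : 0 < m
    0<m = ≤-trans (s≤s z≤n) 4≤m

  -- Every vertex of a hole of G[B] has a neighbour on it, so the hole lies in B.
  induced-holeFree : ∀ {ℓ B} → NoHoleAtLeast G ℓ → NoHoleAtLeast (induced B) ℓ
  induced-holeFree {B = B} noHole m ℓ≤m h = noHole m ℓ≤m record
    { atLeast4 = Hole.atLeast4 h ; vert = Hole.vert h ; inj = Hole.inj h ; induced-cycle = cycle }
    where
    ∈B : ∀ i → Hole.vert h i ∈ᵇ B
    ∈B i = proj₁ (induced-~⁻ {B} (proj₂ (Hole.induced-cycle h i _) (proj₂ (cycle-successor (Hole.atLeast4 h) i))))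
    cycle : ∀ i j → (Hole.vert h i ~ Hole.vert h j → CycAdj G m i j) × (CycAdj G m i j → Hole.vert h i ~ Hole.vert h j)
    cycle i j = proj₁ (Hole.induced-cycle h i j) ∘ induced-~⁺ {B} (∈B i) (∈B j) ,
                proj₂ ∘ proj₂ ∘ induced-~⁻ {B} ∘ proj₂ (Hole.induced-cycle h i j)

  cone : ∀ {S x k} → Clique (induced (N¹ S x)) (suc (suc k)) → Clique G (suc (suc (suc k)))
  cone {S} {x} {k} c = record { vert = vert ; pairwise = pairwise }
    where
    other : Fin (suc (suc k)) → Fin (suc (suc k))
    other fzero    = fsuc fzero
    other (fsuc _) = fzero
    other-≢ : ∀ i → i ≢ other i
    other-≢ fzero    ()
    other-≢ (fsuc _) ()
    ~x : ∀ i → Clique.vert c i ~ x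
    ~x i = proj₂ (∈N¹⁻ (proj₁ (induced-~⁻ {N¹ S x} (Clique.pairwise c i (other i) (other-≢ i)))))
    vert : Fin (suc (suc (suc k))) → V
    vert fzero    = x
    vert (fsuc i) = Clique.vert c i
    pairwise : ∀ i j → i ≢ j → vert i ~ vert j
    pairwise fzero    fzero    i≢j = ⊥-elim (i≢j refl)
    pairwise fzero    (fsuc j) _   = ~-sym (~x j)
    pairwise (fsuc i) fzero    _   = ~x i
    pairwise (fsuc i) (fsuc j) i≢j = proj₂ (proj₂ (induced-~⁻ {N¹ S x} (Clique.pairwise c i j (i≢j ∘ cong fsuc))))

  N¹-colouring : ∀ {ℓ k κ} → 1 ≤ k →
    (∀ (H : Graph) → NoHoleAtLeast H ℓ → CliqueNumberBelow H k → ChiAtMost H (AllVertices H) κ) →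
    NoHoleAtLeast G ℓ → CliqueNumberBelow G (suc k) → ∀ S x → Colouring (N¹ S x) κ
  N¹-colouring {k = suc zero} _ _ _ noClique S x = colouring-∅ λ v v∈N¹ → noClique record
    { vert = λ { fzero → v ; (fsuc _) → x }
    ; pairwise = λ { fzero        fzero        i≢j → ⊥-elim (i≢j refl)
                   ; fzero        (fsuc fzero) _   → proj₂ (∈N¹⁻ v∈N¹)
                   ; (fsuc fzero) fzero        _   → ~-sym (proj₂ (∈N¹⁻ v∈N¹))
                   ; (fsuc fzero) (fsuc fzero) i≢j → ⊥-elim (i≢j refl) } }
  N¹-colouring {k = suc (suc k)} _ hyp noHole noClique S x
    with hyp (induced (N¹ S x)) (induced-holeFree noHole) (noClique ∘ cone)
  ... | col , proper = (λ v → toℕ (col v tt)) , (λ _ → toℕ<n _) ,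
                       λ u∈N¹ v∈N¹ u~v → proper _ _ tt tt (induced-~⁺ {N¹ S x} u∈N¹ v∈N¹ u~v) ∘ toℕ-injective

  singleton : ∀ {S : Subset size} {x} → x ∈ᵇ Vec.lookup S → CliqueIn G S 1
  singleton {S} {x} x∈S = record
    { clique = record { vert = λ _ → x ; pairwise = λ { fzero fzero 0≢0 → ⊥-elim (0≢0 refl) } }
    ; inside = λ _ → lookup⇒[]= x S x∈S }

  N²⊆N2 : ∀ {S : Subset size} {x} (x∈S : x ∈ᵇ Vec.lookup S) {v} →
          v ∈ᵇ N² (Vec.lookup S) x → N2 G S (singleton x∈S) v
  N²⊆N2 {S} _ v∈N² with ∈N²⁻ v∈N²
  ... | v∈S , v≁x , v≢x , u , u∈S , u~x , v~u =
    lookup⇒[]= _ S v∈S , const v≢x , (u , (lookup⇒[]= u S u∈S , const (~⇒≢ u~x) , const u~x) , v~u) , const v≁x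

  N²-colourable? : ∀ S n x → Dec (x ∈ᵇ S → Colouring (N² S x) n)
  N²-colourable? S n x = x ∈ᵇ? S →-dec colouring? (N² S x) n

  clique-controlled-by-N² : ∀ {φ} →
    (∀ S n → (∀ {x} → x ∈ᵇ S → Colouring (N² S x) n) → Colouring S (φ n)) → CliqueControlled G 1 φ
  clique-controlled-by-N² bound S n ¬colour-S with all? (N²-colourable? (Vec.lookup S) n)
  ... | yes colour-N² = ⊥-elim (¬colour-S (Colouring⇒Colourable (λ v∈S → []=⇒lookup v∈S)
                          (bound (Vec.lookup S) n (colour-N² _))))
  ... | no ¬colour-N² with ¬∀⟶∃¬ size _ (N²-colourable? (Vec.lookup S) n) ¬colour-N²
  ...   | x , ¬colour-N²x with x ∈ᵇ? Vec.lookup S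
  ...     | no  x∉S = ⊥-elim (¬colour-N²x (⊥-elim ∘ x∉S))
  ...     | yes x∈S = singleton x∈S , ¬colour-N²x ∘ const ∘ Colourable⇒Colouring (N²⊆N2 x∈S)

mainTheorem12 : (ℓ k κ : ℕ) → 4 ≤ ℓ → 1 ≤ k →
    (∀ (H : Graph) → NoHoleAtLeast H ℓ → CliqueNumberBelow H k →
      ChiAtMost H (AllVertices H) κ) →
    ∀ (G : Graph) → NoHoleAtLeast G ℓ → CliqueNumberBelow G (suc k) →
      CliqueControlled G 1 (φ₁ ℓ κ)
mainTheorem12 ℓ k κ 4≤ℓ 1≤k hyp G noHole noClique = clique-controlled-by-N² λ S n χN² →
  subst (Colouring S) (φ₁≡ n)
    (HoleFreeColouring.colouring S L κ n 1≤L noHole′ (λ {x} _ → N¹-colouring 1≤k hyp noHole noClique S x) χN²)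
  where
  open GraphTheory G
  L = ℓ ∸ 3
  1≤L : 1 ≤ L
  1≤L = ∸-monoˡ-≤ 3 4≤ℓ
  noHole′ : NoHoleAtLeast G (L + 3)
  noHole′ = subst (NoHoleAtLeast G) (sym (m∸n+n≡m (≤-trans (n≤1+n 3) 4≤ℓ))) noHole
  φ₁≡ : ∀ n → suc (L * (κ + n) + L * (κ + n)) ≡ φ₁ ℓ κ n
  φ₁≡ n = sym (trans (+-comm (2 * L * (κ + n)) 1)
                     (cong suc (trans (*-assoc 2 L (κ + n)) (cong (L * (κ + n) +_) (+-identityʳ _)))))
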